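{- Let $P,Q$ be integers and let $(U_n(P,Q))_{n\ge 0}$ be the Lucas sequence of the first type. Suppose $P$ is odd with $P \equiv -1 \pmod 4$, $n$ is even, and $Q \equiv 0 \pmod 4$. Then $U_n(P,Q)$ is not a non-zero perfect square, i.e. there is no nonzero integer $m$ with $U_n(P,Q)=m^2$.
   Context: For fixed integers $P,Q$, the Lucas sequence of the first type is defined by $U_0(P,Q)=0$, $U_1(P,Q)=1$, and $U_n(P,Q)=P\cdot U_{n-1}(P,Q)-Q\cdot U_{n-2}(P,Q)$ for $n\ge 2$. -}

module Defs where

open import Data.Nat using (ℕ; zero; suc)
open import Data.Integer using (ℤ; +_; _-_; _*_)

U : ℤ → ℤ → ℕ → ℤ
U P Q zero = + 0
U P Q (suc zero) = + 1
U P Q (suc (suc n)) = P * U P Q (suc n) - Q * U P Q n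

-- Reducing modulo 4 turns P, Q into -1, 0, and the Lucas sequence of (-1, 0) is
-- 0, 1, -1, 1, -1, …; so every U with even positive index is ≡ -1 (mod 4), which
-- no square is, while U₀ = 0 is the excluded zero square.
module Submission where

open import Defs
open import Data.Nat using (ℕ)
open import Data.Integer using (ℤ; +_; _+_; _*_)
open import Data.Integer.Divisibility using (_∣_)
open import Relation.Binary.PropositionalEquality using (_≡_)
open import Relation.Nullary using (¬_)
open import Data.Product using (∃-syntax; _×_)

open import Data.Nat using (zero; suc)
import Data.Nat as ℕ
import Data.Nat.Divisibility as ℕ
open import Data.Integer using (_-_; -_; _%_; _/_; NonZero)
open import Data.Integer.Properties using (i*j≡0⇒i≡0∨j≡0; neg-involutive; +-identityʳ)
open import Data.Integer.DivMod using (a≡a%n+[a/n]*n; n%d<d)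
open import Data.Integer.Divisibility.Signed as Signed
  using (divides; ∣ᵤ⇒∣; _∣?_; ∣m∣n⇒∣m+n; ∣m∣n⇒∣m-n; ∣m⇒∣-m; ∣m⇒∣m*n; ∣n⇒∣m*n)
open import Data.Integer.Tactic.RingSolver using (solve-∀)
open import Data.Product using (_,_)
open import Data.Sum using ([_,_])
open import Relation.Binary.PropositionalEquality using (refl; sym; trans; cong; subst; module ≡-Reasoning)
open import Relation.Nullary.Decidable using (toWitnessFalse)

infix 4 _≡_[mod_]

record _≡_[mod_] (a b d : ℤ) : Set where
  constructor ≡-mod
  field d∣a-b : d Signed.∣ a - b

≡-mod-refl : ∀ {d a} → a ≡ a [mod d ]
≡-mod-refl {d} {a} = ≡-mod (divides (+ 0) (a-a≡0*d a d))
  where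
  a-a≡0*d : ∀ a d → a - a ≡ + 0 * d
  a-a≡0*d = solve-∀

≡-mod-sym : ∀ {d a b} → a ≡ b [mod d ] → b ≡ a [mod d ]
≡-mod-sym {d} {a} {b} (≡-mod a≡b) = ≡-mod (subst (d Signed.∣_) (negate a b) (∣m⇒∣-m a≡b))
  where
  negate : ∀ a b → - (a - b) ≡ b - a
  negate = solve-∀

≡-mod-trans : ∀ {d a b c} → a ≡ b [mod d ] → b ≡ c [mod d ] → a ≡ c [mod d ]
≡-mod-trans {d} {a} {b} {c} (≡-mod a≡b) (≡-mod b≡c) =
  ≡-mod (subst (d Signed.∣_) (telescope a b c) (∣m∣n⇒∣m+n a≡b b≡c))
  where
  telescope : ∀ a b c → (a - b) + (b - c) ≡ a - c
  telescope = solve-∀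

minus-cong-mod : ∀ {d a a′ b b′} → a ≡ a′ [mod d ] → b ≡ b′ [mod d ] → a - b ≡ a′ - b′ [mod d ]
minus-cong-mod {d} {a} {a′} {b} {b′} (≡-mod a≡a′) (≡-mod b≡b′) =
  ≡-mod (subst (d Signed.∣_) (regroup a a′ b b′) (∣m∣n⇒∣m-n a≡a′ b≡b′))
  where
  regroup : ∀ a a′ b b′ → (a - a′) - (b - b′) ≡ (a - b) - (a′ - b′)
  regroup = solve-∀

*-cong-mod : ∀ {d a a′ b b′} → a ≡ a′ [mod d ] → b ≡ b′ [mod d ] → a * b ≡ a′ * b′ [mod d ]
*-cong-mod {d} {a} {a′} {b} {b′} (≡-mod a≡a′) (≡-mod b≡b′) =
  ≡-mod (subst (d Signed.∣_) (regroup a a′ b b′) (∣m∣n⇒∣m+n (∣m⇒∣m*n b a≡a′) (∣n⇒∣m*n a′ b≡b′)))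
  where
  regroup : ∀ a a′ b b′ → (a - a′) * b + a′ * (b - b′) ≡ a * b - a′ * b′
  regroup = solve-∀

≡-mod-% : ∀ a n .{{_ : NonZero n}} → a ≡ + (a % n) [mod n ]
≡-mod-% a n = ≡-mod (divides (a / n) (trans (cong (_- r) (a≡a%n+[a/n]*n a n)) (cancel r (a / n) n)))
  where
  r = + (a % n)
  cancel : ∀ r q n → r + q * n - r ≡ q * n
  cancel = solve-∀

U-cong-mod : ∀ {d P P′ Q Q′} → P ≡ P′ [mod d ] → Q ≡ Q′ [mod d ] →
             ∀ n → U P Q n ≡ U P′ Q′ n [mod d ]
U-cong-mod P≡P′ Q≡Q′ zero = ≡-mod-refl
U-cong-mod P≡P′ Q≡Q′ (suc zero) = ≡-mod-refl
U-cong-mod P≡P′ Q≡Q′ (suc (suc n)) =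
  minus-cong-mod (*-cong-mod P≡P′ (U-cong-mod P≡P′ Q≡Q′ (suc n)))
             (*-cong-mod Q≡Q′ (U-cong-mod P≡P′ Q≡Q′ n))

U[-1,0]-suc-suc : ∀ n → U (- + 1) (+ 0) (suc (suc n)) ≡ - U (- + 1) (+ 0) (suc n)
U[-1,0]-suc-suc n = simplify (U (- + 1) (+ 0) (suc n)) (U (- + 1) (+ 0) n)
  where
  simplify : ∀ x y → - + 1 * x - + 0 * y ≡ - x
  simplify = solve-∀

U[-1,0]-even : ∀ k → U (- + 1) (+ 0) (suc (suc (k ℕ.* 2))) ≡ - + 1
U[-1,0]-even zero = refl
U[-1,0]-even (suc k) = begin
  U (- + 1) (+ 0) (4 ℕ.+ k ℕ.* 2)     ≡⟨ U[-1,0]-suc-suc (2 ℕ.+ k ℕ.* 2) ⟩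
  - U (- + 1) (+ 0) (3 ℕ.+ k ℕ.* 2)   ≡⟨ cong -_ (U[-1,0]-suc-suc (1 ℕ.+ k ℕ.* 2)) ⟩
  - - U (- + 1) (+ 0) (2 ℕ.+ k ℕ.* 2) ≡⟨ neg-involutive _ ⟩
  U (- + 1) (+ 0) (2 ℕ.+ k ℕ.* 2)     ≡⟨ U[-1,0]-even k ⟩
  - + 1                               ∎
  where open ≡-Reasoning

residue²≢-1-mod4 : ∀ r → r ℕ.< 4 → ¬ (+ r * + r ≡ - + 1 [mod + 4 ])
residue²≢-1-mod4 0 _ (≡-mod 4∣1) = toWitnessFalse {a? = + 4 ∣? + 1} _ 4∣1
residue²≢-1-mod4 1 _ (≡-mod 4∣2) = toWitnessFalse {a? = + 4 ∣? + 2} _ 4∣2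
residue²≢-1-mod4 2 _ (≡-mod 4∣5) = toWitnessFalse {a? = + 4 ∣? + 5} _ 4∣5
residue²≢-1-mod4 3 _ (≡-mod 4∣10) = toWitnessFalse {a? = + 4 ∣? + 10} _ 4∣10
residue²≢-1-mod4 (suc (suc (suc (suc _)))) (ℕ.s≤s (ℕ.s≤s (ℕ.s≤s (ℕ.s≤s ()))))

square≢-1-mod4 : ∀ m → ¬ (m * m ≡ - + 1 [mod + 4 ])
square≢-1-mod4 m m²≡-1 = residue²≢-1-mod4 (m % + 4) (n%d<d m (+ 4))
  (≡-mod-trans (≡-mod-sym (*-cong-mod m≡r m≡r)) m²≡-1)
  where
  m≡r : m ≡ + (m % + 4) [mod + 4 ]
  m≡r = ≡-mod-% m (+ 4)

theorem3p3 : (P Q : ℤ) (n : ℕ) →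
    ¬ ((+ 2) ∣ P) → (+ 4) ∣ (P + + 1) → (+ 2) ∣ (+ n) → (+ 4) ∣ Q →
    ¬ (∃[ m ] (¬ (m ≡ + 0) × U P Q n ≡ m * m))
theorem3p3 P Q .0 _ _ (ℕ.divides zero refl) _ (m , m≢0 , 0≡m²) =
  [ m≢0 , m≢0 ] (i*j≡0⇒i≡0∨j≡0 m (sym 0≡m²))
theorem3p3 P Q .(suc (suc (k ℕ.* 2))) _ 4∣P+1 (ℕ.divides (suc k) refl) 4∣Q (m , _ , Uₙ≡m²) =
  square≢-1-mod4 m (subst (λ x → x ≡ - + 1 [mod + 4 ]) Uₙ≡m² Uₙ≡-1)
  where
  P≡-1 : P ≡ - + 1 [mod + 4 ]
  P≡-1 = ≡-mod (∣ᵤ⇒∣ 4∣P+1)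
  Q≡0 : Q ≡ + 0 [mod + 4 ]
  Q≡0 = ≡-mod (subst (+ 4 Signed.∣_) (sym (+-identityʳ Q)) (∣ᵤ⇒∣ 4∣Q))
  Uₙ≡-1 : U P Q (suc (suc (k ℕ.* 2))) ≡ - + 1 [mod + 4 ]
  Uₙ≡-1 = subst (λ x → U P Q (suc (suc (k ℕ.* 2))) ≡ x [mod + 4 ])
                (U[-1,0]-even k) (U-cong-mod P≡-1 Q≡0 (suc (suc (k ℕ.* 2))))
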